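{- Let $n=p_1p_2\cdots p_r$, where $r\geq 3$ and $p_1<p_2<\cdots<p_r$ are prime numbers, and let $3\leq s\leq r$. Then $\deg(p_{s-1}p_s\cdots p_r)\geq\deg(p_sp_{s+1}\cdots p_r)$ in $\mathcal{P}(C_n)$ if and only if $$p_sp_{s+1}\cdots p_r\geq\left(\frac{p_1p_2\cdots p_{s-2}}{\phi(p_1p_2\cdots p_{s-2})}-1\right)\phi(p_{s-1})+1.$$ Further, $\deg(p_{s-1}p_s\cdots p_r)=\deg(p_sp_{s+1}\cdots p_r)$ if and only if equality holds in this inequality.
   Context: For a finite group $G$, the power graph $\mathcal{P}(G)$ is the simple undirected graph with vertex set $G$ in which two distinct vertices are adjacent if one of them is an integral power of the other. $C_n$ denotes the cyclic group of order $n$, identified with $\mathbb{Z}_n=\{0,1,\ldots,n-1\}$; a positive divisor $d$ of $n$ is regarded as the vertex $d \bmod n$. $\deg(a)$ denotes the degree of vertex $a$ in $\mathcal{P}(C_n)$ and $\phi$ Euler's totient function. -}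

module Defs where

open import Data.Nat using (ℕ; zero; suc; _*_; _+_; _∸_; NonZero)
open import Data.Nat.DivMod using (_%_)
open import Data.Nat.GCD using (gcd)
open import Data.Nat.Properties using (_≟_)
open import Data.Fin using (Fin; toℕ)
open import Data.Fin.Properties using (any?)
open import Data.List using (List; length; filter; upTo; map)
open import Data.Product using (Σ; _×_; ∃-syntax)
open import Data.Sum using (_⊎_)
open import Relation.Nullary using (¬_; Dec)
open import Relation.Nullary.Decidable using (_×-dec_; _⊎-dec_; ¬?)
open import Relation.Binary.PropositionalEquality using (_≡_)
open import Data.Integer using (+_)
open import Data.Rational using (ℚ; _/_; 0ℚ)

-- C_n is identified with ℤ_n = {0,…,n-1}, written additively: the k-th power of a is k·a mod n.
-- Since C_n has order n, the integral powers of a are exactly k·a mod n for k ∈ {0,…,n-1}.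
-- b is an integral power of a in C_(suc m)
IsPowerOf : (m a b : ℕ) → Set
IsPowerOf m a b = ∃[ k ] ((toℕ {suc m} k * a) % suc m ≡ b)

isPowerOf? : ∀ m a b → Dec (IsPowerOf m a b)
isPowerOf? m a b = any? λ k → ((toℕ {suc m} k * a) % suc m) ≟ b

Adj : (m a b : ℕ) → Set
Adj m a b = ¬ (a ≡ b) × (IsPowerOf m a b ⊎ IsPowerOf m b a)

adj? : ∀ m a b → Dec (Adj m a b)
adj? m a b = ¬? (a ≟ b) ×-dec (isPowerOf? m a b ⊎-dec isPowerOf? m b a)

-- deg n a : degree of the vertex (a mod n) in 𝒫(C_n); the vertex set is {0,…,n-1}.
-- (C_0 is not a group; deg 0 a = 0 by convention, never used.)
deg : ℕ → ℕ → ℕ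
deg zero    a = 0
deg (suc m) a = length (filter (adj? m (a % suc m)) (upTo (suc m)))

φ : ℕ → ℕ
φ m = length (filter (λ k → gcd k m ≟ 1) (map suc (upTo m)))

-- product p_i p_(i+1) ⋯ p_j of a sequence (empty product = 1 when j < i)
-- prodFrom p i l = p_i ⋯ p_(i+l-1)
prodFrom : (ℕ → ℕ) → ℕ → ℕ → ℕ
prodFrom p i zero    = 1
prodFrom p i (suc l) = p i * prodFrom p (suc i) l

prodRange : (ℕ → ℕ) → ℕ → ℕ → ℕ
prodRange p i j = prodFrom p i (suc j ∸ i)

-- a / b as a rational number (b ≥ 1 in all uses; a/0 := 0 by convention)
_÷ℕ_ : ℕ → ℕ → ℚ
a ÷ℕ zero  = 0ℚ
a ÷ℕ suc b = (+ a) / suc b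

module Submission where

-- Write n = P·q·b with P = p₁ ⋯ p_(s-2), q = p_(s-1) and b = p_s ⋯ p_r, so that a = q·b.
-- The key fact is a closed formula for the degree of a vertex a of 𝒫(C_N) when N = P·a
-- with P ⊥ a: the neighbours of a are the multiples of a (its powers) and the residues
-- coprime to P (the elements having a among their powers), so by inclusion–exclusion
--     deg(a) + 1 + φ(P) = P + a·φ(P).
-- Applied to a = q·b (cofactor P) and to b (cofactor P·q), together with
-- φ(P·q) = (q - 1)·φ(P), this shows that deg(a) - deg(b) has the sign of
-- b·φ(P) + (q - 1)·φ(P) - (P·(q - 1) + φ(P)); clearing the denominator φ(P) in the
-- rational threshold (P/φ(P) - 1)·φ(q) + 1 gives exactly this comparison.

open import Defs

module Counting where

  open import Data.Bool using (Bool; true; false; _∧_; _∨_; not)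
  open import Data.List using (length; filter; applyUpTo)
  open import Data.Nat
  open import Data.Nat.Properties
  open import Data.Nat.Divisibility using (_∣?_; ∣-refl; _∣0; >⇒∤; ∣m+n∣m⇒∣n; ∣m∣n⇒∣m+n)
  open import Function using (_∘_)
  open import Relation.Nullary using (does)
  open import Relation.Nullary.Decidable using (dec-true; dec-false; does-⇔)
  open import Function.Bundles using (mk⇔)
  open import Relation.Unary using (Decidable)
  open import Relation.Binary.PropositionalEquality

  indicator : Bool → ℕ
  indicator true  = 1
  indicator false = 0

  count : (ℕ → Bool) → ℕ → ℕ
  count f zero    = 0
  count f (suc n) = indicator (f 0) + count (f ∘ suc) n

  length-filter : ∀ {P : ℕ → Set} (P? : Decidable P) (g : ℕ → ℕ) n →
    length (filter P? (applyUpTo g n)) ≡ count (λ x → does (P? (g x))) n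
  length-filter P? g zero = refl
  length-filter P? g (suc n) with does (P? (g zero))
  ... | true  = cong suc (length-filter P? (g ∘ suc) n)
  ... | false = length-filter P? (g ∘ suc) n

  count-ext : ∀ (f g : ℕ → Bool) n → (∀ x → x < n → f x ≡ g x) → count f n ≡ count g n
  count-ext f g zero    f≗g = refl
  count-ext f g (suc n) f≗g = cong₂ _+_ (cong indicator (f≗g 0 z<s))
    (count-ext (f ∘ suc) (g ∘ suc) n (λ x x<n → f≗g (suc x) (s<s x<n)))

  count-const : ∀ b n → count (λ _ → b) n ≡ n * indicator b
  count-const b zero    = refl
  count-const b (suc n) = cong (indicator b +_) (count-const b n)

  count-+ : ∀ (f : ℕ → Bool) a b → count f (a + b) ≡ count f a + count (λ x → f (a + x)) b
  count-+ f zero    b = refl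
  count-+ f (suc a) b = trans (cong (indicator (f 0) +_) (count-+ (f ∘ suc) a b))
                              (sym (+-assoc (indicator (f 0)) _ _))

  count-shift : ∀ (f : ℕ → Bool) n → f 0 ≡ f n → count (f ∘ suc) n ≡ count f n
  count-shift f n f0≡fn = +-cancelˡ-≡ (indicator (f 0)) _ _ (begin
    indicator (f 0) + count (f ∘ suc) n     ≡⟨⟩
    count f (suc n)                         ≡⟨ cong (count f) (+-comm 1 n) ⟩
    count f (n + 1)                         ≡⟨ count-+ f n 1 ⟩
    count f n + (indicator (f (n + 0)) + 0) ≡⟨ cong (count f n +_) (+-identityʳ _) ⟩
    count f n + indicator (f (n + 0))       ≡⟨ cong (λ k → count f n + indicator (f k)) (+-identityʳ n) ⟩
    count f n + indicator (f n)             ≡⟨ cong (λ b → count f n + indicator b) (sym f0≡fn) ⟩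
    count f n + indicator (f 0)             ≡⟨ +-comm (count f n) _ ⟩
    indicator (f 0) + count f n             ∎)
    where open ≡-Reasoning

  count-∨ : ∀ (f g : ℕ → Bool) n →
    count (λ x → f x ∨ g x) n + count (λ x → f x ∧ g x) n ≡ count f n + count g n
  count-∨ f g zero = refl
  count-∨ f g (suc n) with f 0 | g 0 | count-∨ (f ∘ suc) (g ∘ suc) n
  ... | true  | true  | ih = cong suc (trans (+-suc _ _) (trans (cong suc ih) (sym (+-suc _ _))))
  ... | true  | false | ih = cong suc ih
  ... | false | true  | ih = trans (cong suc ih) (sym (+-suc _ _))
  ... | false | false | ih = ih

  count-split : ∀ (f g : ℕ → Bool) n →
    count (λ x → f x ∧ not (g x)) n + count (λ x → f x ∧ g x) n ≡ count f n
  count-split f g zero = refl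
  count-split f g (suc n) with f 0 | g 0 | count-split (f ∘ suc) (g ∘ suc) n
  ... | true  | true  | ih = trans (+-suc _ _) (cong suc ih)
  ... | true  | false | ih = cong suc ih
  ... | false | _     | ih = ih

  count-periodic : ∀ (f : ℕ → Bool) M → (∀ x → f (M + x) ≡ f x) →
    ∀ c → count f (c * M) ≡ c * count f M
  count-periodic f M periodic zero    = refl
  count-periodic f M periodic (suc c) = trans (count-+ f M (c * M))
    (cong (count f M +_) (trans (count-ext _ f (c * M) (λ x _ → periodic x))
                                (count-periodic f M periodic c)))

  count-remove : ∀ (f : ℕ → Bool) n a → a < n → f a ≡ true →
    count (λ x → not (does (a ≟ x)) ∧ f x) n + 1 ≡ count f n
  count-remove f (suc n) zero    _         fa rewrite fa =
    trans (+-comm _ 1) (cong suc (count-ext _ _ n (λ _ _ → refl)))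
  count-remove f (suc n) (suc a) (s≤s a<n) fa =
    trans (+-assoc (indicator (f 0)) _ 1) (cong (indicator (f 0) +_)
      (trans (cong (_+ 1) (count-ext _ _ n (λ _ _ → refl))) (count-remove (f ∘ suc) n a a<n fa)))

  multipleOf : ℕ → ℕ → Bool
  multipleOf d x = does (d ∣? x)

  multipleOf-periodic : ∀ d x → multipleOf d (d + x) ≡ multipleOf d x
  multipleOf-periodic d x =
    does-⇔ (mk⇔ (λ d∣d+x → ∣m+n∣m⇒∣n d∣d+x ∣-refl) (∣m∣n⇒∣m+n ∣-refl)) (d ∣? (d + x)) (d ∣? x)

  count-multiples : ∀ A .{{_ : NonZero A}} (g : ℕ → Bool) c →
    count (λ x → multipleOf A x ∧ g x) (c * A) ≡ count (λ k → g (k * A)) c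
  count-multiples A       g zero    = refl
  count-multiples A@(suc a) g (suc c) =
    trans (count-+ (λ x → multipleOf A x ∧ g x) A (c * A)) (cong₂ _+_ firstBlock laterBlocks)
    where
    -- in [0, A) only x = 0 is a multiple of A
    firstBlock : count (λ x → multipleOf A x ∧ g x) A ≡ indicator (g 0)
    firstBlock rewrite dec-true (A ∣? 0) (A ∣0) = begin
      indicator (g 0) + count (λ x → multipleOf A (suc x) ∧ g (suc x)) a
        ≡⟨ cong (indicator (g 0) +_) (count-ext _ (λ _ → false) a
             (λ x x<a → cong (_∧ g (suc x)) (dec-false (A ∣? suc x) (>⇒∤ (s<s x<a))))) ⟩
      indicator (g 0) + count (λ _ → false) a
        ≡⟨ cong (indicator (g 0) +_) (trans (count-const false a) (*-zeroʳ a)) ⟩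
      indicator (g 0) + 0
        ≡⟨ +-identityʳ _ ⟩
      indicator (g 0) ∎
      where open ≡-Reasoning
    laterBlocks : count (λ x → multipleOf A (A + x) ∧ g (A + x)) (c * A) ≡ count (λ k → g (suc k * A)) c
    laterBlocks = trans (count-ext _ _ (c * A) (λ x _ → cong (_∧ g (A + x)) (multipleOf-periodic A x)))
                        (count-multiples A (λ x → g (A + x)) c)

module Coprimality where

  open Counting
  open import Data.Bool using (Bool; _∧_)
  open import Data.Nat
  open import Data.Nat.Properties
  open import Data.Nat.Divisibility
  open import Data.Nat.GCD using (gcd)
  open import Data.Nat.Coprimality as Coprime using (Coprime)
  open import Data.Product using (_,_)
  open import Function.Bundles using (_⇔_; mk⇔)
  open import Function.Construct.Composition using (_⇔-∘_)
  open import Relation.Nullary using (Dec; does)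
  open import Relation.Nullary.Decidable using (does-⇔)
  open import Relation.Binary.PropositionalEquality

  coprimeTo : ℕ → ℕ → Bool
  coprimeTo P x = does (gcd x P ≟ 1)

  coprimeTo-reflects : ∀ P x {B : Set} (B? : Dec B) → Coprime x P ⇔ B → coprimeTo P x ≡ does B?
  coprimeTo-reflects P x B? x⊥P⇔B = does-⇔
    (x⊥P⇔B ⇔-∘ mk⇔ Coprime.gcd≡1⇒coprime Coprime.coprime⇒gcd≡1) (gcd x P ≟ 1) B?

  coprimeTo-⇔ : ∀ P x Q y → (Coprime x P → Coprime y Q) → (Coprime y Q → Coprime x P) →
    coprimeTo P x ≡ coprimeTo Q y
  coprimeTo-⇔ P x Q y to from =
    coprimeTo-reflects P x (gcd y Q ≟ 1) (mk⇔ to′ from′)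
    where
    to′ : Coprime x P → gcd y Q ≡ 1
    to′ x⊥P = Coprime.coprime⇒gcd≡1 (to x⊥P)
    from′ : gcd y Q ≡ 1 → Coprime x P
    from′ e = from (Coprime.gcd≡1⇒coprime e)

  coprimeTo-periodic : ∀ P x → coprimeTo P (P + x) ≡ coprimeTo P x
  coprimeTo-periodic P x = coprimeTo-⇔ P (P + x) P x
    (λ c (i∣x , i∣P) → c (∣m∣n⇒∣m+n i∣P i∣x , i∣P))
    (λ c (i∣P+x , i∣P) → c (∣m+n∣m⇒∣n i∣P+x i∣P , i∣P))

  coprime-*ʳ : ∀ {x y z} → Coprime x y → Coprime x z → Coprime x (y * z)
  coprime-*ʳ x⊥y x⊥z (i∣x , i∣yz) =
    x⊥z (i∣x , Coprime.coprime-divisor (λ (j∣i , j∣y) → x⊥y (∣-trans j∣i i∣x , j∣y)) i∣yz)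

  coprime-*ˡ : ∀ {x y z} → Coprime x z → Coprime y z → Coprime (x * y) z
  coprime-*ˡ x⊥z y⊥z = Coprime.sym (coprime-*ʳ (Coprime.sym x⊥z) (Coprime.sym y⊥z))

  coprimeTo-*unit : ∀ P a k → Coprime P a → coprimeTo P (k * a) ≡ coprimeTo P k
  coprimeTo-*unit P a k P⊥a = coprimeTo-⇔ P (k * a) P k
    (λ ka⊥P (i∣k , i∣P) → ka⊥P (∣m⇒∣m*n a i∣k , i∣P))
    (λ k⊥P {i} (i∣ka , i∣P) →
       k⊥P (Coprime.coprime-divisor (λ (j∣i , j∣a) → P⊥a (∣-trans j∣i i∣P , j∣a))
                                    (subst (i ∣_) (*-comm k a) i∣ka) , i∣P))

  φ₀ : ℕ → ℕ
  φ₀ P = count (coprimeTo P) P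

  count-coprimeTo-periods : ∀ P c → count (coprimeTo P) (c * P) ≡ c * φ₀ P
  count-coprimeTo-periods P = count-periodic (coprimeTo P) P (coprimeTo-periodic P)

  count-coprime-multiples : ∀ P A .{{_ : NonZero A}} → Coprime P A →
    count (λ x → multipleOf A x ∧ coprimeTo P x) (P * A) ≡ φ₀ P
  count-coprime-multiples P A P⊥A =
    trans (count-multiples A (coprimeTo P) P)
          (count-ext _ _ P (λ k _ → coprimeTo-*unit P A k P⊥A))

module PowerGraph where

  open Counting
  open Coprimality
  open import Data.Bool using (Bool; true; _∧_; _∨_; not)
  open import Data.Bool.Properties using (∧-identityʳ)
  open import Data.Fin using (Fin; toℕ; fromℕ<)
  open import Data.Fin.Properties using (toℕ-fromℕ<)
  open import Data.Nat
  open import Data.Nat.Properties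
  open import Data.Nat.DivMod
  open import Data.Nat.Divisibility
  open import Data.Nat.GCD
  open import Data.Nat.Coprimality as Coprime using (Coprime)
  open import Data.Nat.Tactic.RingSolver using (solve-∀)
  open import Data.Product using (∃; _,_)
  open import Function.Bundles using (_⇔_; mk⇔)
  open import Function.Construct.Composition using (_⇔-∘_)
  open import Function.Construct.Symmetry using (⇔-sym)
  open import Relation.Nullary using (does)
  open import Relation.Nullary.Decidable using (dec-true; does-⇔)
  open import Relation.Binary.PropositionalEquality

  *-cong-mod : ∀ a a′ b b′ N .{{_ : NonZero N}} → a % N ≡ a′ % N → b % N ≡ b′ % N →
    (a * b) % N ≡ (a′ * b′) % N
  *-cong-mod a a′ b b′ N a≡a′ b≡b′ =
    trans (%-distribˡ-* a b N)
      (trans (cong₂ (λ u v → (u * v) % N) a≡a′ b≡b′) (sym (%-distribˡ-* a′ b′ N)))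

  -- Every multiple c·x mod N is a power of x: reduce the exponent c mod N first.
  multiple⇒power : ∀ m x c → IsPowerOf m x ((c * x) % suc m)
  multiple⇒power m x c =
    k , *-cong-mod (toℕ k) c x x N (trans (cong (_% N) (toℕ-fromℕ< c%N<N)) (m%n%n≡m%n c N)) refl
    where
    N = suc m
    c%N<N : c % N < N
    c%N<N = m%n<n c N
    k : Fin N
    k = fromℕ< c%N<N

  powers-of-divisor : ∀ m a x → a ∣ suc m → x < suc m → IsPowerOf m a x ⇔ a ∣ x
  powers-of-divisor m a x a∣N x<N = mk⇔ power⇒multiple multiple⇒power-of-a
    where
    power⇒multiple : IsPowerOf m a x → a ∣ x
    power⇒multiple (k , eq) = subst (a ∣_) eq (%-presˡ-∣ (n∣m*n (toℕ k)) a∣N)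
    multiple⇒power-of-a : a ∣ x → IsPowerOf m a x
    multiple⇒power-of-a (divides j refl) =
      subst (IsPowerOf m a) (m<n⇒m%n≡m x<N) (multiple⇒power m a j)

  gcd-is-multiple : ∀ m x → ∃ λ c → (c * x) % suc m ≡ gcd x (suc m) % suc m
  gcd-is-multiple m x with Bézout.identity (gcd-GCD x (suc m))
  ... | Bézout.+- u y g+yN≡ux = u , (begin
    (u * x) % N          ≡⟨ cong (_% N) (sym g+yN≡ux) ⟩
    (g + y * N) % N      ≡⟨ [m+kn]%n≡m%n g y N ⟩
    g % N                ∎)
    where
    open ≡-Reasoning
    N = suc m
    g = gcd x N
  ... | Bézout.-+ u y g+ux≡yN = m * u , (begin
    (m * u * x) % N                ≡⟨ sym ([m+kn]%n≡m%n (m * u * x) g N) ⟩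
    (m * u * x + g * N) % N        ≡⟨ cong (_% N) (regroup m u x g) ⟩
    (g + m * (g + u * x)) % N      ≡⟨ cong (λ z → (g + m * z) % N) g+ux≡yN ⟩
    (g + m * (y * N)) % N          ≡⟨ cong (λ z → (g + z) % N) (sym (*-assoc m y N)) ⟩
    (g + m * y * N) % N            ≡⟨ [m+kn]%n≡m%n g (m * y) N ⟩
    g % N                          ∎)
    where
    open ≡-Reasoning
    N = suc m
    g = gcd x N
    regroup : ∀ m u x g → m * u * x + g * suc m ≡ g + m * (g + u * x)
    regroup = solve-∀

  reaches⇔gcd∣ : ∀ m x a → a < suc m → IsPowerOf m x a ⇔ gcd x (suc m) ∣ a
  reaches⇔gcd∣ m x a a<N = mk⇔ power⇒gcd∣ gcd∣⇒power
    where
    N = suc m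
    g = gcd x N
    power⇒gcd∣ : IsPowerOf m x a → g ∣ a
    power⇒gcd∣ (k , eq) =
      subst (g ∣_) eq (%-presˡ-∣ (∣n⇒∣m*n (toℕ k) (gcd[m,n]∣m x N)) (gcd[m,n]∣n x N))
    gcd∣⇒power : g ∣ a → IsPowerOf m x a
    gcd∣⇒power (divides w refl) with gcd-is-multiple m x
    ... | c , cx≡g = subst (IsPowerOf m x) (begin
      (w * c * x) % N     ≡⟨ cong (_% N) (*-assoc w c x) ⟩
      (w * (c * x)) % N   ≡⟨ *-cong-mod w w (c * x) g N refl cx≡g ⟩
      (w * g) % N         ≡⟨ m<n⇒m%n≡m a<N ⟩
      w * g               ∎) (multiple⇒power m x (w * c))
      where open ≡-Reasoning

  gcd∣cofactor⇔coprime : ∀ P a x → Coprime P a → gcd x (P * a) ∣ a ⇔ Coprime x P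
  gcd∣cofactor⇔coprime P a x P⊥a = mk⇔ gcd∣a⇒coprime coprime⇒gcd∣a
    where
    gcd∣a⇒coprime : gcd x (P * a) ∣ a → Coprime x P
    gcd∣a⇒coprime g∣a (i∣x , i∣P) = P⊥a (i∣P , ∣-trans (gcd-greatest i∣x (∣m⇒∣m*n a i∣P)) g∣a)
    coprime⇒gcd∣a : Coprime x P → gcd x (P * a) ∣ a
    coprime⇒gcd∣a x⊥P = Coprime.coprime-divisor g⊥P (gcd[m,n]∣n x (P * a))
      where
      g⊥P : Coprime (gcd x (P * a)) P
      g⊥P (i∣g , i∣P) = x⊥P (∣-trans i∣g (gcd[m,n]∣m x (P * a)) , i∣P)

  adjacent⇔ : ∀ P a m → P * a ≡ suc m → Coprime P a → a < suc m → ∀ x → x < suc m →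
    does (adj? m a x) ≡ not (does (a ≟ x)) ∧ (multipleOf a x ∨ coprimeTo P x)
  adjacent⇔ P a m P*a≡N P⊥a a<N x x<N = cong (not (does (a ≟ x)) ∧_) (cong₂ _∨_ a-reaches-x x-reaches-a)
    where
    a-reaches-x : does (isPowerOf? m a x) ≡ multipleOf a x
    a-reaches-x = does-⇔ (powers-of-divisor m a x (subst (a ∣_) P*a≡N (n∣m*n P)) x<N)
                         (isPowerOf? m a x) (a ∣? x)
    x-reaches-a : does (isPowerOf? m x a) ≡ coprimeTo P x
    x-reaches-a = sym (coprimeTo-reflects P x (isPowerOf? m x a)
      (⇔-sym (gcd∣cofactor⇔coprime P a x P⊥a ⇔-∘ subst (λ N → IsPowerOf m x a ⇔ gcd x N ∣ a)
                                                       (sym P*a≡N) (reaches⇔gcd∣ m x a a<N))))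

  -- The degree of a in 𝒫(C_{P·a}) for P ⊥ a, P ≥ 2: multiples of a (P of them) plus residues
  -- coprime to P (a·φ₀(P)), minus their overlap (φ₀(P)) and minus a itself.
  degree-formula : ∀ P A .{{_ : NonZero A}} → 2 ≤ P → Coprime P A →
    deg (P * A) A + 1 + φ₀ P ≡ P + A * φ₀ P
  degree-formula (suc zero)          _           (s≤s ())
  degree-formula P@(suc (suc P-2)) A@(suc A-1) 2≤P P⊥A = begin
    deg N A + 1 + φ₀ P
      ≡⟨ cong (λ d → d + 1 + φ₀ P) degree-as-count ⟩
    count neighbour N + 1 + φ₀ P
      ≡⟨ cong (_+ φ₀ P) (count-remove closed N A A<N A-closed) ⟩
    count closed N + φ₀ P
      ≡⟨ cong (count closed N +_) (sym (count-coprime-multiples P A P⊥A)) ⟩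
    count closed N + count (λ x → multipleOf A x ∧ coprimeTo P x) N
      ≡⟨ count-∨ (multipleOf A) (coprimeTo P) N ⟩
    count (multipleOf A) N + count (coprimeTo P) N
      ≡⟨ cong₂ _+_ count-multiples-of-A (trans (cong (count (coprimeTo P)) (*-comm P A))
                                               (count-coprimeTo-periods P A)) ⟩
    P + A * φ₀ P ∎
    where
    open ≡-Reasoning
    N = P * A
    m = A-1 + suc P-2 * A
    A<N : A < suc m
    A<N = s≤s (m<m+n A-1 {suc P-2 * A} z<s)
    closed neighbour : ℕ → Bool
    closed x = multipleOf A x ∨ coprimeTo P x
    neighbour x = not (does (A ≟ x)) ∧ closed x
    A-closed : closed A ≡ true
    A-closed = cong (_∨ coprimeTo P A) (dec-true (A ∣? A) ∣-refl)
    degree-as-count : deg N A ≡ count neighbour N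
    degree-as-count = begin
      deg N A
        ≡⟨ length-filter (adj? m (A % suc m)) (λ x → x) N ⟩
      count (λ x → does (adj? m (A % suc m) x)) N
        ≡⟨ cong (λ a → count (λ x → does (adj? m a x)) N) (m<n⇒m%n≡m A<N) ⟩
      count (λ x → does (adj? m A x)) N
        ≡⟨ count-ext _ _ N (adjacent⇔ P A m refl P⊥A A<N) ⟩
      count neighbour N ∎
    count-multiples-of-A : count (multipleOf A) N ≡ P
    count-multiples-of-A = begin
      count (multipleOf A) N
        ≡⟨ count-ext _ _ N (λ x _ → sym (∧-identityʳ (multipleOf A x))) ⟩
      count (λ x → multipleOf A x ∧ true) N
        ≡⟨ count-multiples A (λ _ → true) P ⟩
      count (λ _ → true) P
        ≡⟨ count-const true P ⟩
      P * 1
        ≡⟨ *-identityʳ P ⟩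
      P ∎

module Totient where

  open Counting
  open Coprimality
  open import Data.Bool using (_∧_; not)
  open import Data.Bool.Properties using (∧-comm)
  open import Data.List using (_∷_; length; filter; map; applyUpTo)
  open import Data.Nat
  open import Data.Nat.Properties
  open import Data.Nat.Divisibility
  open import Data.Nat.GCD using (gcd; gcd-zeroˡ)
  open import Data.Nat.Coprimality as Coprime using (Coprime)
  open import Data.Nat.Primality using (Prime; prime⇒irreducible; prime⇒nonZero; ¬prime[1])
  open import Data.Product using (_×_; _,_)
  open import Data.Sum using ([_,_]′)
  open import Function using (_∘_)
  open import Function.Bundles using (mk⇔)
  open import Relation.Nullary using (¬_; does; contradiction)
  open import Relation.Nullary.Decidable using (_×-dec_; ¬?; dec-true)
  open import Relation.Binary.PropositionalEquality

  map-applyUpTo : ∀ (f g : ℕ → ℕ) n → map f (applyUpTo g n) ≡ applyUpTo (f ∘ g) n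
  map-applyUpTo f g zero    = refl
  map-applyUpTo f g (suc n) = cong (f (g 0) ∷_) (map-applyUpTo f (g ∘ suc) n)

  -- φ counts 1, …, P and φ₀ counts 0, …, P-1; they agree since 0 ≡ P mod P.
  φ≡φ₀ : ∀ P → φ P ≡ φ₀ P
  φ≡φ₀ P = begin
    φ P
      ≡⟨ cong (length ∘ filter (λ k → gcd k P ≟ 1)) (map-applyUpTo suc (λ x → x) P) ⟩
    length (filter (λ k → gcd k P ≟ 1) (applyUpTo suc P))
      ≡⟨ length-filter (λ k → gcd k P ≟ 1) suc P ⟩
    count (coprimeTo P ∘ suc) P
      ≡⟨ count-shift (coprimeTo P) P endpoints ⟩
    φ₀ P ∎
    where
    open ≡-Reasoning
    endpoints : coprimeTo P 0 ≡ coprimeTo P P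
    endpoints = sym (trans (cong (coprimeTo P) (sym (+-identityʳ P))) (coprimeTo-periodic P 0))

  prime∤⇒coprime : ∀ {q x} → Prime q → ¬ q ∣ x → Coprime q x
  prime∤⇒coprime q-prime q∤x (d∣q , d∣x) =
    [ (λ d≡1 → d≡1) , (λ { refl → contradiction d∣x q∤x }) ]′ (prime⇒irreducible q-prime d∣q)

  coprimeTo-*prime : ∀ P q → Prime q → ∀ x → coprimeTo (P * q) x ≡ coprimeTo P x ∧ not (multipleOf q x)
  coprimeTo-*prime P q q-prime x =
    coprimeTo-reflects (P * q) x ((gcd x P ≟ 1) ×-dec ¬? (q ∣? x)) (mk⇔ split join)
    where
    split : Coprime x (P * q) → gcd x P ≡ 1 × ¬ q ∣ x
    split x⊥Pq = Coprime.coprime⇒gcd≡1 (λ (i∣x , i∣P) → x⊥Pq (i∣x , ∣m⇒∣m*n q i∣P))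
               , λ q∣x → ¬prime[1] (subst Prime (x⊥Pq (q∣x , n∣m*n P)) q-prime)
    join : gcd x P ≡ 1 × ¬ q ∣ x → Coprime x (P * q)
    join (gcd≡1 , q∤x) =
      coprime-*ʳ (Coprime.gcd≡1⇒coprime gcd≡1) (Coprime.sym (prime∤⇒coprime q-prime q∤x))

  φ₀-*prime : ∀ P q → Prime q → Coprime P q → φ₀ (P * q) + φ₀ P ≡ q * φ₀ P
  φ₀-*prime P q q-prime P⊥q = begin
    φ₀ (P * q) + φ₀ P
      ≡⟨ cong₂ _+_ (count-ext _ _ (P * q) (λ x _ → coprimeTo-*prime P q q-prime x)) (sym multiplesOfQ) ⟩
    count (λ x → coprimeTo P x ∧ not (multipleOf q x)) (P * q)
      + count (λ x → coprimeTo P x ∧ multipleOf q x) (P * q)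
      ≡⟨ count-split (coprimeTo P) (multipleOf q) (P * q) ⟩
    count (coprimeTo P) (P * q)
      ≡⟨ cong (count (coprimeTo P)) (*-comm P q) ⟩
    count (coprimeTo P) (q * P)
      ≡⟨ count-coprimeTo-periods P q ⟩
    q * φ₀ P ∎
    where
    open ≡-Reasoning
    instance _ = prime⇒nonZero q-prime
    multiplesOfQ : count (λ x → coprimeTo P x ∧ multipleOf q x) (P * q) ≡ φ₀ P
    multiplesOfQ = trans (count-ext _ _ (P * q) (λ x _ → ∧-comm (coprimeTo P x) (multipleOf q x)))
                         (count-coprime-multiples P q P⊥q)

  -- φ(q) = q - 1 for a prime q: the case P = 1 of φ₀-*prime.
  φ-prime : ∀ q → Prime q → φ q + 1 ≡ q
  φ-prime q q-prime = begin
    φ q + 1           ≡⟨ cong₂ _+_ (φ≡φ₀ q) refl ⟩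
    φ₀ q + φ₀ 1       ≡⟨ cong (λ n → φ₀ n + φ₀ 1) (sym (*-identityˡ q)) ⟩
    φ₀ (1 * q) + φ₀ 1 ≡⟨ φ₀-*prime 1 q q-prime (Coprime.1-coprimeTo q) ⟩
    q * 1             ≡⟨ *-identityʳ q ⟩
    q                 ∎
    where open ≡-Reasoning

  -- For P ≥ 2 the residue 1 is coprime to P, so φ₀(P) ≥ 1.
  φ₀-positive : ∀ P → 2 ≤ P → 1 ≤ φ₀ P
  φ₀-positive P 2≤P =
    subst (1 ≤_) (count-remove (coprimeTo P) P 1 2≤P (dec-true (gcd 1 P ≟ 1) (gcd-zeroˡ P))) (m≤n+m 1 _)

module RationalForm where

  open import Data.Nat as ℕ using (ℕ; suc)
  import Data.Nat.Properties as ℕ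
  open import Data.Integer as ℤ using (ℤ; +_; -[1+_])
  import Data.Integer.Properties as ℤ
  open import Data.Integer.Tactic.RingSolver using (solve-∀)
  open import Data.Rational as ℚ using (ℚ; 1ℚ; toℚᵘ)
  import Data.Rational.Properties as ℚ
  open import Data.Rational.Unnormalised as ℚᵘ using (ℚᵘ; mkℚᵘ; ↥_; ↧_; 1ℚᵘ; *≡*; *≤*)
  import Data.Rational.Unnormalised.Properties as ℚᵘ
  open import Function.Bundles using (_⇔_; mk⇔)
  open import Function.Construct.Composition using (_⇔-∘_)
  open import Relation.Binary.PropositionalEquality

  -- Adding the same integer c to both sides turns a comparison of integers into
  -- one of natural numbers.
  unshift : ∀ x c → x ℤ.+ c ℤ.+ ℤ.- c ≡ x
  unshift = solve-∀

  shift-≤ : ∀ (L R c : ℤ) {m n : ℕ} → L ℤ.+ c ≡ + m → R ℤ.+ c ≡ + n → L ℤ.≤ R ⇔ m ℕ.≤ n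
  shift-≤ L R c {m} {n} L+c≡m R+c≡n = mk⇔
    (λ L≤R → ℤ.drop‿+≤+ (subst₂ ℤ._≤_ L+c≡m R+c≡n (ℤ.+-monoˡ-≤ c L≤R)))
    (λ m≤n → subst₂ ℤ._≤_ (unshift L c) (unshift R c)
               (ℤ.+-monoˡ-≤ (ℤ.- c) (subst₂ ℤ._≤_ (sym L+c≡m) (sym R+c≡n) (ℤ.+≤+ m≤n))))

  shift-≡ : ∀ (L R c : ℤ) {m n : ℕ} → L ℤ.+ c ≡ + m → R ℤ.+ c ≡ + n → L ≡ R ⇔ m ≡ n
  shift-≡ L R c L+c≡m R+c≡n = mk⇔
    (λ L≡R → ℤ.+-injective (trans (sym L+c≡m) (trans (cong (ℤ._+ c) L≡R) R+c≡n)))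
    (λ m≡n → trans (sym (unshift L c)) (trans (cong (λ z → z ℤ.+ ℤ.- c)
               (trans L+c≡m (trans (cong +_ m≡n) (sym R+c≡n)))) (unshift R c)))

  ≤⇔cross : ∀ {p q : ℚ} {p′ q′ : ℚᵘ} → toℚᵘ p ℚᵘ.≃ p′ → toℚᵘ q ℚᵘ.≃ q′ →
    p ℚ.≤ q ⇔ (↥ p′ ℤ.* ↧ q′) ℤ.≤ (↥ q′ ℤ.* ↧ p′)
  ≤⇔cross p≃p′ q≃q′ = mk⇔
    (λ p≤q → unwrap (ℚᵘ.≤-respʳ-≃ q≃q′ (ℚᵘ.≤-respˡ-≃ p≃p′ (ℚ.toℚᵘ-mono-≤ p≤q))))
    (λ cross → ℚ.toℚᵘ-cancel-≤ (ℚᵘ.≤-respʳ-≃ (ℚᵘ.≃-sym q≃q′) (ℚᵘ.≤-respˡ-≃ (ℚᵘ.≃-sym p≃p′) (*≤* cross))))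
    where
    unwrap : ∀ {x y} → x ℚᵘ.≤ y → (↥ x ℤ.* ↧ y) ℤ.≤ (↥ y ℤ.* ↧ x)
    unwrap (*≤* x≤y) = x≤y

  ≡⇔cross : ∀ {p q : ℚ} {p′ q′ : ℚᵘ} → toℚᵘ p ℚᵘ.≃ p′ → toℚᵘ q ℚᵘ.≃ q′ →
    p ≡ q ⇔ (↥ p′ ℤ.* ↧ q′) ≡ (↥ q′ ℤ.* ↧ p′)
  ≡⇔cross p≃p′ q≃q′ = mk⇔
    (λ p≡q → unwrap (ℚᵘ.≃-trans (ℚᵘ.≃-sym p≃p′) (ℚᵘ.≃-trans (ℚ.toℚᵘ-cong p≡q) q≃q′)))
    (λ cross → ℚ.toℚᵘ-injective (ℚᵘ.≃-trans p≃p′ (ℚᵘ.≃-trans (*≡* cross) (ℚᵘ.≃-sym q≃q′))))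
    where
    unwrap : ∀ {x y} → x ℚᵘ.≃ y → (↥ x ℤ.* ↧ y) ≡ (↥ y ℤ.* ↧ x)
    unwrap (*≡* x≃y) = x≃y

  module Threshold (P Q Φ-1 : ℕ) where

    Φ : ℕ
    Φ = suc Φ-1

    -- The right-hand side (P/Φ - 1)·Q + 1 of the theorem's inequality, with Φ = φ(P), Q = φ(q).
    threshold : ℚ
    threshold = ((P ÷ℕ Φ) ℚ.- 1ℚ) ℚ.* (Q ÷ℕ 1) ℚ.+ 1ℚ

    thresholdᵘ : ℚᵘ
    thresholdᵘ = ((mkℚᵘ (+ P) Φ-1 ℚᵘ.- 1ℚᵘ) ℚᵘ.* mkℚᵘ (+ Q) 0) ℚᵘ.+ 1ℚᵘ

    threshold≃ : toℚᵘ threshold ℚᵘ.≃ thresholdᵘ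
    threshold≃ = ℚᵘ.≃-trans (ℚ.toℚᵘ-homo-+ (((P ÷ℕ Φ) ℚ.- 1ℚ) ℚ.* (Q ÷ℕ 1)) 1ℚ) (ℚᵘ.+-congˡ 1ℚᵘ
      (ℚᵘ.≃-trans (ℚ.toℚᵘ-homo-* ((P ÷ℕ Φ) ℚ.- 1ℚ) (Q ÷ℕ 1)) (ℚᵘ.*-cong
        (ℚᵘ.≃-trans (ℚ.toℚᵘ-homo-+ (P ÷ℕ Φ) (ℚ.- 1ℚ))
                    (ℚᵘ.+-cong (ℚ.toℚᵘ-fromℚᵘ (mkℚᵘ (+ P) Φ-1)) (ℚ.toℚᵘ-homo‿- 1ℚ)))
        (ℚ.toℚᵘ-fromℚᵘ (mkℚᵘ (+ Q) 0)))))

    -- thresholdᵘ = ((P - Φ)·Q + Φ) / Φ, with the numerator shifted to be a natural number.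
    ↧threshold : ↧ thresholdᵘ ≡ + Φ
    ↧threshold = cong +_ (trans (ℕ.*-identityʳ (Φ ℕ.* 1 ℕ.* 1))
                        (trans (ℕ.*-identityʳ (Φ ℕ.* 1)) (ℕ.*-identityʳ Φ)))

    ↥threshold : ↥ thresholdᵘ ℤ.+ + (Q ℕ.* Φ) ≡ + (P ℕ.* Q ℕ.+ Φ)
    ↥threshold = begin
      ↥ thresholdᵘ ℤ.+ + (Q ℕ.* Φ)
        ≡⟨ cong₂ (λ d e → numerator (+ P) (+ Q) (+ Φ) d ℤ.+ e)
                 (cong +_ (trans (ℕ.*-identityʳ (Φ ℕ.* 1)) (ℕ.*-identityʳ Φ))) (ℤ.pos-* Q Φ) ⟩
      numerator (+ P) (+ Q) (+ Φ) (+ Φ) ℤ.+ + Q ℤ.* + Φ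
        ≡⟨ regroup (+ P) (+ Q) (+ Φ) ⟩
      + P ℤ.* + Q ℤ.+ + Φ
        ≡⟨ cong (ℤ._+ + Φ) (sym (ℤ.pos-* P Q)) ⟩
      + (P ℕ.* Q) ℤ.+ + Φ
        ≡⟨ sym (ℤ.pos-+ (P ℕ.* Q) Φ) ⟩
      + (P ℕ.* Q ℕ.+ Φ) ∎
      where
      open ≡-Reasoning
      numerator : ℤ → ℤ → ℤ → ℤ → ℤ
      numerator p q f d = ((p ℤ.* + 1 ℤ.+ -[1+ 0 ] ℤ.* f) ℤ.* q) ℤ.* + 1 ℤ.+ + 1 ℤ.* d
      regroup : ∀ p q f →
        ((p ℤ.* + 1 ℤ.+ -[1+ 0 ] ℤ.* f) ℤ.* q) ℤ.* + 1 ℤ.+ + 1 ℤ.* f ℤ.+ q ℤ.* f ≡ p ℤ.* q ℤ.+ f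
      regroup = solve-∀

    module _ (b : ℕ) where

      bᵘ : ℚᵘ
      bᵘ = mkℚᵘ (+ b) 0

      b≃ : toℚᵘ (b ÷ℕ 1) ℚᵘ.≃ bᵘ
      b≃ = ℚ.toℚᵘ-fromℚᵘ bᵘ

      thresholdSide : ↥ thresholdᵘ ℤ.* ↧ bᵘ ℤ.+ + (Q ℕ.* Φ) ≡ + (P ℕ.* Q ℕ.+ Φ)
      thresholdSide = trans (cong (ℤ._+ + (Q ℕ.* Φ)) (ℤ.*-identityʳ (↥ thresholdᵘ))) ↥threshold

      bSide : ↥ bᵘ ℤ.* ↧ thresholdᵘ ℤ.+ + (Q ℕ.* Φ) ≡ + (b ℕ.* Φ ℕ.+ Q ℕ.* Φ)
      bSide = begin
        + b ℤ.* ↧ thresholdᵘ ℤ.+ + (Q ℕ.* Φ) ≡⟨ cong (λ d → + b ℤ.* d ℤ.+ + (Q ℕ.* Φ)) ↧threshold ⟩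
        + b ℤ.* + Φ ℤ.+ + (Q ℕ.* Φ)          ≡⟨ cong (ℤ._+ + (Q ℕ.* Φ)) (sym (ℤ.pos-* b Φ)) ⟩
        + (b ℕ.* Φ) ℤ.+ + (Q ℕ.* Φ)          ≡⟨ sym (ℤ.pos-+ (b ℕ.* Φ) (Q ℕ.* Φ)) ⟩
        + (b ℕ.* Φ ℕ.+ Q ℕ.* Φ)              ∎
        where open ≡-Reasoning

      threshold≤⇔ : threshold ℚ.≤ (b ÷ℕ 1) ⇔ P ℕ.* Q ℕ.+ Φ ℕ.≤ b ℕ.* Φ ℕ.+ Q ℕ.* Φ
      threshold≤⇔ = shift-≤ _ _ (+ (Q ℕ.* Φ)) thresholdSide bSide ⇔-∘ ≤⇔cross threshold≃ b≃

      threshold≡⇔ : (b ÷ℕ 1 ≡ threshold) ⇔ (b ℕ.* Φ ℕ.+ Q ℕ.* Φ ≡ P ℕ.* Q ℕ.+ Φ)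
      threshold≡⇔ = shift-≡ _ _ (+ (Q ℕ.* Φ)) bSide thresholdSide ⇔-∘ ≡⇔cross b≃ threshold≃

module Comparison where

  open Coprimality
  open PowerGraph
  open Totient
  open RationalForm
  open import Data.Nat
  open import Data.Nat.Properties
  open import Data.Nat.Coprimality as Coprime using (Coprime)
  open import Data.Nat.Primality using (Prime; prime⇒nonZero)
  open import Data.Nat.Tactic.RingSolver using (solve-∀)
  open import Data.Product using (_×_; _,_; proj₁; proj₂)
  open import Data.Rational as ℚ using (1ℚ)
  open import Function.Bundles using (_⇔_; mk⇔)
  open import Function.Construct.Composition using (_⇔-∘_)
  open import Function.Construct.Symmetry using (⇔-sym)
  open import Relation.Nullary using (contradiction)
  open import Relation.Binary.PropositionalEquality

  offset-compare : ∀ {x y u v} K C → x + K ≡ C + u → y + K ≡ C + v →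
    (y ≤ x ⇔ v ≤ u) × (x ≡ y ⇔ u ≡ v)
  offset-compare {x} {y} {u} {v} K C x+K≡C+u y+K≡C+v =
    mk⇔ (λ y≤x → +-cancelˡ-≤ C v u (subst₂ _≤_ y+K≡C+v x+K≡C+u (+-monoˡ-≤ K y≤x)))
        (λ v≤u → +-cancelʳ-≤ K y x (subst₂ _≤_ (sym y+K≡C+v) (sym x+K≡C+u) (+-monoʳ-≤ C v≤u))) ,
    mk⇔ (λ x≡y → +-cancelˡ-≡ C u v (trans (sym x+K≡C+u) (trans (cong (_+ K) x≡y) y+K≡C+v)))
        (λ u≡v → +-cancelʳ-≡ K x y (trans x+K≡C+u (trans (cong (C +_) u≡v) (sym y+K≡C+v))))

  -- The arithmetic core. With q = Q + 1, the degree formulas for a = q·B and for B, and the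
  -- multiplicativity X = φ₀(P·q) = Q·Φ, the difference of the degrees is (B + Q)·Φ - (P·Q + Φ).
  degrees-compare : ∀ P q Q B Φ dA dB X → q ≡ suc Q →
    dA + 1 + Φ ≡ P + (q * B) * Φ →
    dB + 1 + X ≡ P * q + B * X →
    X + Φ ≡ q * Φ →
    (dB ≤ dA ⇔ P * Q + Φ ≤ B * Φ + Q * Φ) × (dA ≡ dB ⇔ B * Φ + Q * Φ ≡ P * Q + Φ)
  degrees-compare P .(suc Q) Q B Φ dA dB X refl degreeA degreeB totientPq =
    offset-compare (1 + Φ + Q * Φ) (P + B * Q * Φ) dA+K dB+K
    where
    open ≡-Reasoning
    X≡QΦ : X ≡ Q * Φ
    X≡QΦ = +-cancelʳ-≡ Φ X (Q * Φ) (trans totientPq (+-comm Φ (Q * Φ)))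
    dA+K : dA + (1 + Φ + Q * Φ) ≡ P + B * Q * Φ + (B * Φ + Q * Φ)
    dA+K = begin
      dA + (1 + Φ + Q * Φ)          ≡⟨ regroup dA Φ (Q * Φ) ⟩
      dA + 1 + Φ + Q * Φ            ≡⟨ cong (_+ Q * Φ) degreeA ⟩
      P + (suc Q * B) * Φ + Q * Φ   ≡⟨ expand P Q B Φ ⟩
      P + B * Q * Φ + (B * Φ + Q * Φ) ∎
      where
      regroup : ∀ d f g → d + (1 + f + g) ≡ d + 1 + f + g
      regroup = solve-∀
      expand : ∀ P Q B Φ → P + (suc Q * B) * Φ + Q * Φ ≡ P + B * Q * Φ + (B * Φ + Q * Φ)
      expand = solve-∀
    dB+K : dB + (1 + Φ + Q * Φ) ≡ P + B * Q * Φ + (P * Q + Φ)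
    dB+K = begin
      dB + (1 + Φ + Q * Φ)          ≡⟨ regroup dB Φ (Q * Φ) ⟩
      dB + 1 + Q * Φ + Φ            ≡⟨ cong (λ x → dB + 1 + x + Φ) (sym X≡QΦ) ⟩
      dB + 1 + X + Φ                ≡⟨ cong (_+ Φ) degreeB ⟩
      P * suc Q + B * X + Φ         ≡⟨ cong (λ x → P * suc Q + B * x + Φ) X≡QΦ ⟩
      P * suc Q + B * (Q * Φ) + Φ   ≡⟨ expand P Q B Φ ⟩
      P + B * Q * Φ + (P * Q + Φ)   ∎
      where
      regroup : ∀ d f g → d + (1 + f + g) ≡ d + 1 + g + f
      regroup = solve-∀
      expand : ∀ P Q B Φ → P * suc Q + B * (Q * Φ) + Φ ≡ P + B * Q * Φ + (P * Q + Φ)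
      expand = solve-∀

  degree-comparison : ∀ n a P q b → n ≡ P * a → a ≡ q * b →
    2 ≤ P → Prime q → NonZero b → Coprime P q → Coprime P b → Coprime q b →
    let rhs = ((P ÷ℕ φ P) ℚ.- 1ℚ) ℚ.* ((φ q) ÷ℕ 1) ℚ.+ 1ℚ
    in ((deg n a ≥ deg n b) ⇔ (rhs ℚ.≤ (b ÷ℕ 1))) × ((deg n a ≡ deg n b) ⇔ (b ÷ℕ 1 ≡ rhs))
  degree-comparison .(P * (q * b)) .(q * b) P q b refl refl 2≤P q-prime b≢0 P⊥q P⊥b q⊥b =
    conclude (φ P) (φ q) (sym (φ≡φ₀ P)) refl
    where
    instance
      _ = prime⇒nonZero q-prime
      _ = b≢0
    dA dB : ℕ
    dA = deg (P * (q * b)) (q * b)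
    dB = deg (P * (q * b)) b
    degreeA : dA + 1 + φ₀ P ≡ P + (q * b) * φ₀ P
    degreeA = degree-formula P (q * b) {{m*n≢0 q b}} 2≤P (coprime-*ʳ P⊥q P⊥b)
    degreeB : dB + 1 + φ₀ (P * q) ≡ P * q + b * φ₀ (P * q)
    degreeB = subst (λ n → deg n b + 1 + φ₀ (P * q) ≡ P * q + b * φ₀ (P * q)) (*-assoc P q b)
                    (degree-formula (P * q) b (≤-trans 2≤P (m≤m*n P q)) (coprime-*ˡ P⊥b q⊥b))
    conclude : ∀ Φ Q → φ₀ P ≡ Φ → φ q ≡ Q →
      let rhs = ((P ÷ℕ Φ) ℚ.- 1ℚ) ℚ.* (Q ÷ℕ 1) ℚ.+ 1ℚ
      in ((dA ≥ dB) ⇔ (rhs ℚ.≤ (b ÷ℕ 1))) × ((dA ≡ dB) ⇔ (b ÷ℕ 1 ≡ rhs))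
    conclude zero        Q φ₀P≡0 _    = contradiction φ₀P≡0 (m<n⇒n≢0 (φ₀-positive P 2≤P))
    conclude Φ@(suc Φ-1) Q φ₀P≡Φ φq≡Q =
      ⇔-sym (threshold≤⇔ b) ⇔-∘ proj₁ degrees , ⇔-sym (threshold≡⇔ b) ⇔-∘ proj₂ degrees
      where
      open Threshold P Q Φ-1 using (threshold≤⇔; threshold≡⇔)
      q≡1+Q : q ≡ suc Q
      q≡1+Q = trans (sym (φ-prime q q-prime)) (trans (cong (_+ 1) φq≡Q) (+-comm Q 1))
      degrees : (dB ≤ dA ⇔ P * Q + Φ ≤ b * Φ + Q * Φ) × (dA ≡ dB ⇔ b * Φ + Q * Φ ≡ P * Q + Φ)
      degrees = degrees-compare P q Q b Φ dA dB (φ₀ (P * q)) q≡1+Q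
        (subst (λ Φ → dA + 1 + Φ ≡ P + (q * b) * Φ) φ₀P≡Φ degreeA) degreeB
        (subst (λ Φ → φ₀ (P * q) + Φ ≡ q * Φ) φ₀P≡Φ (φ₀-*prime P q q-prime P⊥q))

module Products where

  open import Data.Nat
  open import Data.Nat.Properties
  open Coprimality using (coprime-*ʳ)
  open import Data.Nat.Coprimality as Coprime using (Coprime)
  open import Relation.Nullary using (yes; no; contradiction)
  open import Relation.Binary.PropositionalEquality

  module _ (p : ℕ → ℕ) where

    prodFrom-closed : ∀ (Q : ℕ → Set) → Q 1 → (∀ {x y} → Q x → Q y → Q (x * y)) →
      ∀ i l → (∀ t → i ≤ t → t < i + l → Q (p t)) → Q (prodFrom p i l)
    prodFrom-closed Q Q1 Q* i zero    Qp = Q1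
    prodFrom-closed Q Q1 Q* i (suc l) Qp = Q* (Qp i ≤-refl (m<m+n i z<s))
      (prodFrom-closed Q Q1 Q* (suc i) l
        (λ t i<t t<i+1+l → Qp t (<⇒≤ i<t) (subst (t <_) (sym (+-suc i l)) t<i+1+l)))

    in-range : ∀ i j t → i ≤ t → t < i + (suc j ∸ i) → t ≤ j
    in-range i j t i≤t t<end with i ≤? suc j
    ... | yes i≤1+j = ≤-pred (subst (t <_) (m+[n∸m]≡n i≤1+j) t<end)
    ... | no  i≰1+j = contradiction i≤t (<⇒≱ (subst (t <_) end≡i t<end))
      where
      end≡i : i + (suc j ∸ i) ≡ i
      end≡i = trans (cong (i +_) (m≤n⇒m∸n≡0 (<⇒≤ (≰⇒> i≰1+j)))) (+-identityʳ i)

    prodRange-closed : ∀ (Q : ℕ → Set) → Q 1 → (∀ {x y} → Q x → Q y → Q (x * y)) →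
      ∀ i j → (∀ t → i ≤ t → t ≤ j → Q (p t)) → Q (prodRange p i j)
    prodRange-closed Q Q1 Q* i j Qp =
      prodFrom-closed Q Q1 Q* i (suc j ∸ i) (λ t i≤t t<end → Qp t i≤t (in-range i j t i≤t t<end))

    prodFrom-+ : ∀ i l m → prodFrom p i (l + m) ≡ prodFrom p i l * prodFrom p (i + l) m
    prodFrom-+ i zero    m = sym (trans (+-identityʳ _) (cong (λ k → prodFrom p k m) (+-identityʳ i)))
    prodFrom-+ i (suc l) m = begin
      p i * prodFrom p (suc i) (l + m)
        ≡⟨ cong (p i *_) (prodFrom-+ (suc i) l m) ⟩
      p i * (prodFrom p (suc i) l * prodFrom p (suc i + l) m)
        ≡⟨ sym (*-assoc (p i) _ _) ⟩
      p i * prodFrom p (suc i) l * prodFrom p (suc i + l) m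
        ≡⟨ cong (λ k → p i * prodFrom p (suc i) l * prodFrom p k m) (sym (+-suc i l)) ⟩
      p i * prodFrom p (suc i) l * prodFrom p (i + suc l) m ∎
      where open ≡-Reasoning

    prodRange-split : ∀ i j k → i ≤ suc j → j ≤ k →
      prodRange p i k ≡ prodRange p i j * prodRange p (suc j) k
    prodRange-split i j k i≤1+j j≤k = begin
      prodFrom p i (suc k ∸ i)
        ≡⟨ cong (λ n → prodFrom p i (n ∸ i)) (sym (m+[n∸m]≡n (s≤s j≤k))) ⟩
      prodFrom p i ((suc j + (k ∸ j)) ∸ i)
        ≡⟨ cong (prodFrom p i) (+-∸-comm (k ∸ j) i≤1+j) ⟩
      prodFrom p i ((suc j ∸ i) + (k ∸ j))
        ≡⟨ prodFrom-+ i (suc j ∸ i) (k ∸ j) ⟩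
      prodFrom p i (suc j ∸ i) * prodFrom p (i + (suc j ∸ i)) (k ∸ j)
        ≡⟨ cong (λ n → prodRange p i j * prodFrom p n (k ∸ j)) (m+[n∸m]≡n i≤1+j) ⟩
      prodRange p i j * prodRange p (suc j) k ∎
      where open ≡-Reasoning

    prodRange-cons : ∀ i j → i ≤ j → prodRange p i j ≡ p i * prodRange p (suc i) j
    prodRange-cons i j i≤j = cong (prodFrom p i) (+-∸-assoc 1 i≤j)

    prodRange-coprime : ∀ x i j → (∀ t → i ≤ t → t ≤ j → Coprime x (p t)) → Coprime x (prodRange p i j)
    prodRange-coprime x = prodRange-closed (Coprime x) (Coprime.sym (Coprime.1-coprimeTo x)) coprime-*ʳ

open Comparison using (degree-comparison)
open Products using (prodRange-split; prodRange-cons)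
open import Data.Nat using (ℕ; suc; _≤_; _<_; _≥_; _∸_; z≤n; s≤s)
open import Data.Nat.Primality using (Prime)
open import Data.Integer using (+_)
open import Data.Rational using (ℚ; _+_; _-_; _*_; 1ℚ)
open import Data.Product using (_×_)
open import Function.Bundles using (_⇔_)
open import Relation.Binary.PropositionalEquality using (_≡_)

module IncreasingPrimes (p : ℕ → ℕ) (r : ℕ)
    (prime : ∀ i → 1 ≤ i → i ≤ r → Prime (p i))
    (increasing : ∀ i j → 1 ≤ i → i < j → j ≤ r → p i < p j) where

  open Products
  open import Data.Nat using (NonZero; s≤s)
  open import Data.Nat.Properties using (≤-trans; <⇒≤; m*n≢0)
  open import Data.Nat.Coprimality as Coprime using (Coprime)
  open import Data.Nat.Primality using (prime⇒nonZero)

  coprime : ∀ {i j} → 1 ≤ i → i < j → j ≤ r → Coprime (p i) (p j)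
  coprime {i} {j} 1≤i i<j j≤r =
    Coprime.sym (Coprime.prime⇒coprime (prime j (≤-trans 1≤i (<⇒≤ i<j)) j≤r)
                  {{prime⇒nonZero (prime i 1≤i (≤-trans (<⇒≤ i<j) j≤r))}}
                  (increasing i j 1≤i i<j j≤r))

  nonZero-range : ∀ i j → 1 ≤ i → j ≤ r → NonZero (prodRange p i j)
  nonZero-range i j 1≤i j≤r =
    prodRange-closed p NonZero _ (λ {x} {y} x≢0 y≢0 → m*n≢0 x y {{x≢0}} {{y≢0}}) i j
      (λ t i≤t t≤j → prime⇒nonZero (prime t (≤-trans 1≤i i≤t) (≤-trans t≤j j≤r)))

  range-coprime-range : ∀ i j k l → 1 ≤ i → j < k → l ≤ r →
    Coprime (prodRange p i j) (prodRange p k l)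
  range-coprime-range i j k l 1≤i j<k l≤r =
    Coprime.sym (prodRange-coprime p _ i j (λ t i≤t t≤j → Coprime.sym
      (prodRange-coprime p (p t) k l (λ t′ k≤t′ t′≤l →
        coprime (≤-trans 1≤i i≤t) (≤-trans (s≤s t≤j) (≤-trans j<k k≤t′)) (≤-trans t′≤l l≤r)))))

  range-coprime-prime : ∀ i j k → 1 ≤ i → j < k → k ≤ r → Coprime (prodRange p i j) (p k)
  range-coprime-prime i j k 1≤i j<k k≤r = Coprime.sym (prodRange-coprime p (p k) i j
    (λ t i≤t t≤j → Coprime.sym (coprime (≤-trans 1≤i i≤t) (≤-trans (s≤s t≤j) j<k) k≤r)))

  prime-coprime-range : ∀ k i j → 1 ≤ k → k < i → j ≤ r → Coprime (p k) (prodRange p i j)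
  prime-coprime-range k i j 1≤k k<i j≤r = prodRange-coprime p (p k) i j
    (λ t i≤t t≤j → coprime 1≤k (≤-trans k<i i≤t) (≤-trans t≤j j≤r))

lemma3p2 : (r : ℕ) → (p : ℕ → ℕ) → 3 ≤ r →
    (∀ i → 1 ≤ i → i ≤ r → Prime (p i)) →
    (∀ i j → 1 ≤ i → i < j → j ≤ r → p i < p j) →
    (s : ℕ) → 3 ≤ s → s ≤ r →
    let n = prodRange p 1 r
        P = prodRange p 1 (s ∸ 2)
        a = prodRange p (s ∸ 1) r
        b = prodRange p s r
        rhs = ((P ÷ℕ φ P) - 1ℚ) * ((φ (p (s ∸ 1))) ÷ℕ 1) + 1ℚ
    in ((deg n a ≥ deg n b) ⇔ (rhs Data.Rational.≤ (b ÷ℕ 1)))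
       × ((deg n a ≡ deg n b) ⇔ (b ÷ℕ 1 ≡ rhs))
-- n = P·a and a = q·b with P = p₁ ⋯ p_(s-2), q = p_(s-1), b = p_s ⋯ p_r pairwise coprime.
lemma3p2 r p _ prime increasing s@(suc (suc (suc K))) (s≤s (s≤s (s≤s _))) s≤r =
  degree-comparison (prodRange p 1 r) (prodRange p (s ∸ 1) r) P (p (s ∸ 1)) (prodRange p s r)
    (prodRange-split p 1 (s ∸ 2) r (s≤s z≤n) s-2≤r)
    (prodRange-cons p (s ∸ 1) r s-1≤r)
    2≤P (prime (s ∸ 1) (s≤s z≤n) s-1≤r) (nonZero-range s r (s≤s z≤n) ≤-refl)
    (range-coprime-prime 1 (s ∸ 2) (s ∸ 1) ≤-refl ≤-refl s-1≤r)
    (range-coprime-range 1 (s ∸ 2) s r ≤-refl (n≤1+n _) ≤-refl)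
    (prime-coprime-range (s ∸ 1) s r (s≤s z≤n) ≤-refl ≤-refl)
  where
  open import Data.Nat.Properties using (≤-refl; ≤-trans; n≤1+n; m≤m*n)
  open Data.Nat using (nonTrivial⇒n>1)
  open import Data.Nat.Primality using (prime⇒nonTrivial)
  open IncreasingPrimes p r prime increasing
  P : ℕ
  P = prodRange p 1 (s ∸ 2)
  s-1≤r : s ∸ 1 ≤ r
  s-1≤r = ≤-trans (n≤1+n _) s≤r
  s-2≤r : s ∸ 2 ≤ r
  s-2≤r = ≤-trans (n≤1+n _) s-1≤r
  -- P = p₁ · (p₂ ⋯ p_(s-2)) with p₁ ≥ 2 and the second factor nonzero
  2≤P : 2 ≤ P
  2≤P = ≤-trans (nonTrivial⇒n>1 (p 1) {{prime⇒nonTrivial (prime 1 ≤-refl (≤-trans (s≤s z≤n) s≤r))}})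
                (m≤m*n (p 1) (prodRange p 2 (s ∸ 2)) {{nonZero-range 2 (s ∸ 2) (s≤s z≤n) s-2≤r}})
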